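{- For all expressions $e\in \mathcal F$ and for all $a\in[\![e]\!]_E$, we have $N(E,\mathcal F)\vdash \underline a \leq e$, where $\underline a$ is any term representing the atom $a$.
   Context: Fix a signature $\Sigma$, variables $X$, and a set $E$ of linear and regular term equations. Expressions are built from variables, symbols of $\Sigma$, $0$, $+$, and least fixpoints $\mu x.e$. Atoms are terms modulo $E$, languages are sets of atoms, and $[\![e]\!]_E$ is the standard language interpretation of $e$ (in the powerset-lifted model of atoms, under $x\mapsto\{x\}$). A fragment $\mathcal F$ is a set of closed expressions containing $0$ and the variables, closed under $+$, operations of $\Sigma$, substitution of variables by elements of $\mathcal F$, sub-expressions, and such that $e[f/x]\in\mathcal F$ whenever $\mu x.e\in\mathcal F$ and $f\in\mathcal F$. $N(E,\mathcal F)$ is the naive axiomatisation over $\mathcal F$: semilattice axioms for $+,0$; strictness and distributivity over $+$ of every symbol of $\Sigma$ in each argument; both directions of each equation of $E$; and for each $\mu x.e\in\mathcal F$, fixpoint unfolding $e[\mu x.e/x]\leq\mu x.e$ and least-prefixpoint induction $e[f/x]\leq f\rightarrow\mu x.e\leq f$ ($f\in\mathcal F$). Derivability uses instances of the axioms, reflexivity, transitivity, and monotonicity of $+$ and the symbols of $\Sigma$. -}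

module Defs where

open import Data.Nat using (ℕ; zero; suc; _<_)
open import Data.Nat.Properties using () renaming (_≟_ to _≟ℕ_)
open import Data.Fin using (Fin)
open import Data.Fin.Properties using () renaming (_≟_ to _≟F_)
open import Data.Product using (Σ; _×_; _,_)
open import Data.Sum using (_⊎_)
open import Data.Empty using (⊥)
open import Data.Unit using (⊤)
open import Data.Bool using (if_then_else_)
open import Level using (Lift)
import Level
open import Relation.Nullary using (does)
open import Relation.Binary.PropositionalEquality using (_≡_; _≢_)

record Signature : Set₁ where
  field
    Sym : Set
    ar  : Sym → ℕ
open Signature public

-- Terms over Σ and X, and expressions (locally nameless: free variables
-- are names from X, mu-bound variables are de Bruijn indices)

module _ (S : Signature) (X : Set) where

  data Term : Set where
    tvar : X → Term
    tapp : (f : Sym S) → (Fin (ar S f) → Term) → Term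

  data Expr : Set where
    var  : X → Expr
    bvar : ℕ → Expr
    𝟘    : Expr
    _⊕_  : Expr → Expr → Expr
    op   : (f : Sym S) → (Fin (ar S f) → Expr) → Expr
    μ    : Expr → Expr                       -- μx.e, body with x as index 0

module _ {S : Signature} {X : Set} where

  infix 4 _occurs-in_

  data _occurs-in_ (x : X) : Term S X → Set where
    here  : x occurs-in tvar x
    there : ∀ {f ts} (i : Fin (ar S f)) → x occurs-in ts i → x occurs-in tapp f ts

  Linear : Term S X → Set
  Linear (tvar x)    = ⊤
  Linear (tapp f ts) =
    ((i : Fin (ar S f)) → Linear (ts i)) ×
    ((i j : Fin (ar S f)) → i ≢ j → (x : X) → x occurs-in ts i → x occurs-in ts j → ⊥)

  Regular : Term S X → Term S X → Set
  Regular s t = (x : X) → (x occurs-in s → x occurs-in t) × (x occurs-in t → x occurs-in s)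

  tsub : (X → Term S X) → Term S X → Term S X
  tsub σ (tvar x)    = σ x
  tsub σ (tapp f ts) = tapp f (λ i → tsub σ (ts i))

  infix 4 _⊢_≈_
  data _⊢_≈_ (E : Term S X → Term S X → Set) : Term S X → Term S X → Set where
    ≈-refl  : ∀ {t} → E ⊢ t ≈ t
    ≈-sym   : ∀ {t u} → E ⊢ t ≈ u → E ⊢ u ≈ t
    ≈-trans : ∀ {t u v} → E ⊢ t ≈ u → E ⊢ u ≈ v → E ⊢ t ≈ v
    ≈-cong  : ∀ {f ts us} → ((i : Fin (ar S f)) → E ⊢ ts i ≈ us i) → E ⊢ tapp f ts ≈ tapp f us
    ≈-ax    : ∀ {s t} → E s t → (σ : X → Term S X) → E ⊢ tsub σ s ≈ tsub σ t

  -- a term as an expression (the representative  a̲  of an atom)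
  ⌜_⌝ : Term S X → Expr S X
  ⌜ tvar x ⌝    = var x
  ⌜ tapp f ts ⌝ = op f (λ i → ⌜ ts i ⌝)

  inst : (X → Expr S X) → Term S X → Expr S X
  inst σ (tvar x)    = σ x
  inst σ (tapp f ts) = op f (λ i → inst σ (ts i))

  substX : (X → Expr S X) → Expr S X → Expr S X
  substX σ (var x)   = σ x
  substX σ (bvar n)  = bvar n
  substX σ 𝟘         = 𝟘
  substX σ (e ⊕ f)   = substX σ e ⊕ substX σ f
  substX σ (op g es) = op g (λ i → substX σ (es i))
  substX σ (μ e)     = μ (substX σ e)

  openAt : ℕ → Expr S X → Expr S X → Expr S X
  openAt k f (var x)   = var x
  openAt k f (bvar n)  = if does (n ≟ℕ k) then f else bvar n
  openAt k f 𝟘         = 𝟘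
  openAt k f (e ⊕ e')  = openAt k f e ⊕ openAt k f e'
  openAt k f (op g es) = op g (λ i → openAt k f (es i))
  openAt k f (μ e)     = μ (openAt (suc k) f e)

  -- e [ f / x ]  for the body e of  μx.e
  _[_] : Expr S X → Expr S X → Expr S X
  e [ f ] = openAt 0 f e

  ClosedAt : ℕ → Expr S X → Set
  ClosedAt k (var x)   = ⊤
  ClosedAt k (bvar n)  = n < k
  ClosedAt k 𝟘         = ⊤
  ClosedAt k (e ⊕ f)   = ClosedAt k e × ClosedAt k f
  ClosedAt k (op g es) = (i : Fin (ar S g)) → ClosedAt k (es i)
  ClosedAt k (μ e)     = ClosedAt (suc k) e

  Closed : Expr S X → Set
  Closed = ClosedAt 0

  _[_≔_] : ∀ {n} → (Fin n → Expr S X) → Fin n → Expr S X → (Fin n → Expr S X)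
  (es [ i ≔ e ]) j = if does (i ≟F j) then e else es j

  record IsFragment (F : Expr S X → Set) : Set where
    field
      closed    : ∀ {e} → F e → Closed e
      has-𝟘     : F 𝟘
      has-var   : (x : X) → F (var x)
      ⊕-closed  : ∀ {e f} → F e → F f → F (e ⊕ f)
      op-closed : ∀ {g es} → ((i : Fin (ar S g)) → F (es i)) → F (op g es)
      subst-closed : ∀ {e} → F e → (σ : X → Expr S X) → ((x : X) → F (σ x)) → F (substX σ e)
      sub-⊕ˡ    : ∀ {e f} → F (e ⊕ f) → F e
      sub-⊕ʳ    : ∀ {e f} → F (e ⊕ f) → F f
      sub-op    : ∀ {g es} → F (op g es) → (i : Fin (ar S g)) → F (es i)
      -- the sub-expression e of μx.e, whatever name is used for x
      sub-μ     : ∀ {e} → F (μ e) → (x : X) → F (e [ var x ])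
      unfold-closed : ∀ {e f} → F (μ e) → F f → F (e [ f ])

  -- Language semantics: languages are predicates on terms; bound
  -- variables are interpreted by an environment, free variables x by {x}.

  Lang : Set₁
  Lang = Term S X → Set

  _∷ₑ_ : Lang → (ℕ → Lang) → (ℕ → Lang)
  (L ∷ₑ β) zero    = L
  (L ∷ₑ β) (suc n) = β n

  ⟦_⟧ : Expr S X → (E : Term S X → Term S X → Set) → (ℕ → Lang) → Term S X → Set₁
  ⟦ var x ⟧   E β t = Lift _ (E ⊢ t ≈ tvar x)
  ⟦ bvar n ⟧  E β t = Lift _ (β n t)
  ⟦ 𝟘 ⟧       E β t = Lift _ ⊥
  ⟦ e ⊕ f ⟧   E β t = ⟦ e ⟧ E β t ⊎ ⟦ f ⟧ E β t
  ⟦ op g es ⟧ E β t =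
    Σ (Fin (ar S g) → Term S X) λ ts →
      ((i : Fin (ar S g)) → ⟦ es i ⟧ E β (ts i)) × Lift (Level.suc Level.zero) (E ⊢ t ≈ tapp g ts)
  -- least fixpoint: intersection of all prefixpoints
  ⟦ μ e ⟧     E β t = (L : Lang) → ((u : Term S X) → ⟦ e ⟧ E (L ∷ₑ β) u → L u) → L t

  ⟦_⟧[_] : Expr S X → (E : Term S X → Term S X → Set) → Term S X → Set₁
  ⟦ e ⟧[ E ] = ⟦ e ⟧ E (λ _ _ → ⊥)

  infix 4 N[_,_]⊢_≤_
  data N[_,_]⊢_≤_ (E : Term S X → Term S X → Set) (F : Expr S X → Set)
       : Expr S X → Expr S X → Set where
    ≤-refl  : ∀ {e} → N[ E , F ]⊢ e ≤ e
    ≤-trans : ∀ {e f g} → N[ E , F ]⊢ e ≤ f → N[ E , F ]⊢ f ≤ g → N[ E , F ]⊢ e ≤ g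
    ⊕-mono  : ∀ {e e' f f'} → N[ E , F ]⊢ e ≤ e' → N[ E , F ]⊢ f ≤ f' →
              N[ E , F ]⊢ e ⊕ f ≤ e' ⊕ f'
    op-mono : ∀ {g es fs} → ((i : Fin (ar S g)) → N[ E , F ]⊢ es i ≤ fs i) →
              N[ E , F ]⊢ op g es ≤ op g fs
    ⊕-assoc₁ : ∀ {e f g} → N[ E , F ]⊢ e ⊕ (f ⊕ g) ≤ (e ⊕ f) ⊕ g
    ⊕-assoc₂ : ∀ {e f g} → N[ E , F ]⊢ (e ⊕ f) ⊕ g ≤ e ⊕ (f ⊕ g)
    ⊕-comm   : ∀ {e f} → N[ E , F ]⊢ e ⊕ f ≤ f ⊕ e
    ⊕-idem₁  : ∀ {e} → N[ E , F ]⊢ e ⊕ e ≤ e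
    ⊕-idem₂  : ∀ {e} → N[ E , F ]⊢ e ≤ e ⊕ e
    ⊕-unit₁  : ∀ {e} → N[ E , F ]⊢ e ⊕ 𝟘 ≤ e
    ⊕-unit₂  : ∀ {e} → N[ E , F ]⊢ e ≤ e ⊕ 𝟘
    𝟘-least  : ∀ {e} → N[ E , F ]⊢ 𝟘 ≤ e
    strict₁ : ∀ {g} (es : Fin (ar S g) → Expr S X) (i : Fin (ar S g)) →
              N[ E , F ]⊢ op g (es [ i ≔ 𝟘 ]) ≤ 𝟘
    strict₂ : ∀ {g} (es : Fin (ar S g) → Expr S X) (i : Fin (ar S g)) →
              N[ E , F ]⊢ 𝟘 ≤ op g (es [ i ≔ 𝟘 ])
    distr₁ : ∀ {g} (es : Fin (ar S g) → Expr S X) (i : Fin (ar S g)) (e f : Expr S X) →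
             N[ E , F ]⊢ op g (es [ i ≔ e ⊕ f ]) ≤ op g (es [ i ≔ e ]) ⊕ op g (es [ i ≔ f ])
    distr₂ : ∀ {g} (es : Fin (ar S g) → Expr S X) (i : Fin (ar S g)) (e f : Expr S X) →
             N[ E , F ]⊢ op g (es [ i ≔ e ]) ⊕ op g (es [ i ≔ f ]) ≤ op g (es [ i ≔ e ⊕ f ])
    E-ax₁ : ∀ {s t} → E s t → (σ : X → Expr S X) → N[ E , F ]⊢ inst σ s ≤ inst σ t
    E-ax₂ : ∀ {s t} → E s t → (σ : X → Expr S X) → N[ E , F ]⊢ inst σ t ≤ inst σ s
    μ-unfold : ∀ {e} → F (μ e) → N[ E , F ]⊢ e [ μ e ] ≤ μ e
    μ-induct : ∀ {e f} → F (μ e) → F f → N[ E , F ]⊢ e [ f ] ≤ f → N[ E , F ]⊢ μ e ≤ f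

module Submission where

-- Induction on the expression, generalised to open expressions: each dangling
-- bound variable is compared with admissible replacements, and is interpreted in
-- the language semantics as the set of atoms lying below all of them. For μx.b
-- the atoms below every admissible μx.b' form a prefixpoint of b, since an atom
-- below b'[μx.b'/x] lies below μx.b' by fixpoint unfolding; hence they contain
-- the least fixpoint.

open import Defs
open import Data.Product using (Σ; _×_; _,_)
open import Data.Nat using (ℕ; zero; suc; _+_; _<_; _≤_; z≤n; s≤s)
open import Data.Nat.Properties using (_≟_; <⇒≢; <-≤-trans; +-suc; +-identityʳ; m<1+n⇒m<n∨m≡n)
open import Data.Fin using (Fin)
open import Data.Sum using (inj₁; inj₂)
open import Data.Empty using (⊥)
open import Level using (lift; lower)
open import Relation.Nullary.Decidable using (dec-true; dec-false)
open import Relation.Binary.PropositionalEquality using (_≡_; _≢_; refl; sym; subst; subst₂)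

module _ {S : Signature} {X : Set} where

  private
    Ex = Expr S X

  openAt-bvar-≡ : (k : ℕ) (g : Ex) → openAt k g (bvar k) ≡ g
  openAt-bvar-≡ k g rewrite dec-true (k ≟ k) refl = refl

  openAt-bvar-≢ : ∀ {n k} (g : Ex) → n ≢ k → openAt k g (bvar n) ≡ bvar n
  openAt-bvar-≢ {n} {k} g n≢k rewrite dec-false (n ≟ k) n≢k = refl

  infixr 5 _∷ᵖ_
  _∷ᵖ_ : (Ex → Set) → (ℕ → Ex → Set) → ℕ → Ex → Set
  (P ∷ᵖ Q) zero    = P
  (P ∷ᵖ Q) (suc n) = Q n

  -- Instance Q k e t: t arises from e by replacing each bound variable with
  -- index k + m that is dangling below k binders by an expression satisfying Q m.
  data Instance (Q : ℕ → Ex → Set) : ℕ → Ex → Ex → Set where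
    var    : ∀ {k} x → Instance Q k (var x) (var x)
    bound  : ∀ {k n} → n < k → Instance Q k (bvar n) (bvar n)
    filled : ∀ {k} m {t} → Q m t → Instance Q k (bvar (k + m)) t
    𝟘      : ∀ {k} → Instance Q k 𝟘 𝟘
    _⊕_    : ∀ {k e e' f f'} → Instance Q k e e' → Instance Q k f f' →
             Instance Q k (e ⊕ f) (e' ⊕ f')
    op     : ∀ {k g es es'} → ((i : Fin (ar S g)) → Instance Q k (es i) (es' i)) →
             Instance Q k (op g es) (op g es')
    μ      : ∀ {k e e'} → Instance Q (suc k) e e' → Instance Q k (μ e) (μ e')

  OpenStable : (ℕ → Ex → Set) → Set
  OpenStable Q = ∀ m {t} j g → Q m t → Q m (openAt j g t)

  Instance-refl : ∀ {Q k} (e : Ex) → ClosedAt k e → Instance Q k e e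
  Instance-refl (var x)   _         = var x
  Instance-refl (bvar n)  n<k       = bound n<k
  Instance-refl 𝟘         _         = 𝟘
  Instance-refl (e ⊕ f)   (ce , cf) = Instance-refl e ce ⊕ Instance-refl f cf
  Instance-refl (op g es) ces       = op (λ i → Instance-refl (es i) (ces i))
  Instance-refl (μ e)     ce        = μ (Instance-refl e ce)

  Instance-openAt-above : ∀ {Q k j e t} → OpenStable Q → (g : Ex) → k ≤ j →
                          Instance Q k e t → Instance Q k e (openAt j g t)
  Instance-openAt-above st g k≤j (var x) = var x
  Instance-openAt-above {Q} {k} st g k≤j (bound {n = n} n<k) =
    subst (Instance Q k (bvar n)) (sym (openAt-bvar-≢ g (<⇒≢ (<-≤-trans n<k k≤j))))
          (bound n<k)
  Instance-openAt-above {j = j} st g k≤j (filled m q) = filled m (st m j g q)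
  Instance-openAt-above st g k≤j 𝟘 = 𝟘
  Instance-openAt-above st g k≤j (p ⊕ q) =
    Instance-openAt-above st g k≤j p ⊕ Instance-openAt-above st g k≤j q
  Instance-openAt-above st g k≤j (op ps) = op (λ i → Instance-openAt-above st g k≤j (ps i))
  Instance-openAt-above st g k≤j (μ p) = μ (Instance-openAt-above st g (s≤s k≤j) p)

  Instance-openAt : ∀ {Q k e t} {P : Ex → Set} → OpenStable Q → (g : Ex) → P g →
                    Instance Q (suc k) e t → Instance (P ∷ᵖ Q) k e (openAt k g t)
  Instance-openAt st g Pg (var x) = var x
  Instance-openAt {Q} {k} {P = P} st g Pg (bound {n = n} n<1+k)
    with m<1+n⇒m<n∨m≡n n<1+k
  ... | inj₁ n<k = subst (Instance (P ∷ᵖ Q) k (bvar n)) (sym (openAt-bvar-≢ g (<⇒≢ n<k)))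
                         (bound n<k)
  ... | inj₂ refl =
    subst₂ (λ n → Instance (P ∷ᵖ Q) k (bvar n)) (+-identityʳ k) (sym (openAt-bvar-≡ k g))
           (filled 0 Pg)
  Instance-openAt {Q} {k} {P = P} st g Pg (filled m {t} q) =
    subst (λ n → Instance (P ∷ᵖ Q) k (bvar n) (openAt k g t)) (+-suc k m)
          (filled (suc m) (st m k g q))
  Instance-openAt st g Pg 𝟘 = 𝟘
  Instance-openAt st g Pg (p ⊕ q) = Instance-openAt st g Pg p ⊕ Instance-openAt st g Pg q
  Instance-openAt st g Pg (op ps) = op (λ i → Instance-openAt st g Pg (ps i))
  Instance-openAt st g Pg (μ p) = μ (Instance-openAt st g Pg p)

module _ {S : Signature} {X : Set} (E : Term S X → Term S X → Set) (F : Expr S X → Set) where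

  private
    Ex = Expr S X

  infix 4 _≲_
  _≲_ : Ex → Ex → Set
  e ≲ f = N[ E , F ]⊢ e ≤ f

  ⊕-upperˡ : ∀ {e f} → e ≲ e ⊕ f
  ⊕-upperˡ = ≤-trans ⊕-unit₂ (⊕-mono ≤-refl 𝟘-least)

  ⊕-upperʳ : ∀ {e f} → f ≲ e ⊕ f
  ⊕-upperʳ = ≤-trans ⊕-upperˡ ⊕-comm

  ⌜tsub⌝≲inst : (σ : X → Term S X) (s : Term S X) → ⌜ tsub σ s ⌝ ≲ inst (λ x → ⌜ σ x ⌝) s
  ⌜tsub⌝≲inst σ (tvar x)    = ≤-refl
  ⌜tsub⌝≲inst σ (tapp f ts) = op-mono (λ i → ⌜tsub⌝≲inst σ (ts i))

  inst≲⌜tsub⌝ : (σ : X → Term S X) (s : Term S X) → inst (λ x → ⌜ σ x ⌝) s ≲ ⌜ tsub σ s ⌝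
  inst≲⌜tsub⌝ σ (tvar x)    = ≤-refl
  inst≲⌜tsub⌝ σ (tapp f ts) = op-mono (λ i → inst≲⌜tsub⌝ σ (ts i))

  ≈⇒≲ : ∀ {a b} → E ⊢ a ≈ b → ⌜ a ⌝ ≲ ⌜ b ⌝
  ≈⇒≳ : ∀ {a b} → E ⊢ a ≈ b → ⌜ b ⌝ ≲ ⌜ a ⌝

  ≈⇒≲ ≈-refl          = ≤-refl
  ≈⇒≲ (≈-sym p)       = ≈⇒≳ p
  ≈⇒≲ (≈-trans p q)   = ≤-trans (≈⇒≲ p) (≈⇒≲ q)
  ≈⇒≲ (≈-cong ps)     = op-mono (λ i → ≈⇒≲ (ps i))
  ≈⇒≲ (≈-ax {s} {t} st σ) =
    ≤-trans (⌜tsub⌝≲inst σ s) (≤-trans (E-ax₁ st _) (inst≲⌜tsub⌝ σ t))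

  ≈⇒≳ ≈-refl          = ≤-refl
  ≈⇒≳ (≈-sym p)       = ≈⇒≲ p
  ≈⇒≳ (≈-trans p q)   = ≤-trans (≈⇒≳ q) (≈⇒≳ p)
  ≈⇒≳ (≈-cong ps)     = op-mono (λ i → ≈⇒≳ (ps i))
  ≈⇒≳ (≈-ax {s} {t} st σ) =
    ≤-trans (⌜tsub⌝≲inst σ t) (≤-trans (E-ax₂ st _) (inst≲⌜tsub⌝ σ s))

  Below : Ex → Term S X → Set
  Below t u = F t → ⌜ u ⌝ ≲ t

  EnvBelow : (ℕ → Ex → Set) → (ℕ → Lang) → Set
  EnvBelow Q β = ∀ n {u t} → β n u → Q n t → Below t u

  module _ (FF : IsFragment F) where
    open IsFragment FF

    ⟦⟧⇒≲-instance : ∀ {Q β e t a} → OpenStable Q → EnvBelow Q β →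
                     Instance Q 0 e t → ⟦ e ⟧ E β a → Below t a
    ⟦⟧⇒≲-instance st below (var x) a∈x _ = ≈⇒≲ (lower a∈x)
    ⟦⟧⇒≲-instance st below (filled m q) a∈β = below m (lower a∈β) q
    ⟦⟧⇒≲-instance st below (p ⊕ q) (inj₁ a∈e) Ft =
      ≤-trans (⟦⟧⇒≲-instance st below p a∈e (sub-⊕ˡ Ft)) ⊕-upperˡ
    ⟦⟧⇒≲-instance st below (p ⊕ q) (inj₂ a∈f) Ft =
      ≤-trans (⟦⟧⇒≲-instance st below q a∈f (sub-⊕ʳ Ft)) ⊕-upperʳ
    ⟦⟧⇒≲-instance st below (op ps) (ts , ts∈es , lift a≈gts) Ft =
      ≤-trans (≈⇒≲ a≈gts)
              (op-mono (λ i → ⟦⟧⇒≲-instance st below (ps i) (ts∈es i) (sub-op Ft i)))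
    ⟦⟧⇒≲-instance {Q} {β} st below (μ {e = b} {e' = b'} p) a∈μb =
      a∈μb L L-prefixpoint (b' , refl , p)
      where
        FixInstance : Ex → Set
        FixInstance t = Σ Ex λ c → t ≡ μ c × Instance Q 1 b c

        L : Lang
        L u = ∀ {t} → FixInstance t → Below t u

        FixInstance-stable : OpenStable (FixInstance ∷ᵖ Q)
        FixInstance-stable zero j g (c , refl , q) =
          openAt (suc j) g c , refl , Instance-openAt-above st g (s≤s z≤n) q
        FixInstance-stable (suc m) = st m

        L-below : EnvBelow (FixInstance ∷ᵖ Q) (L ∷ₑ β)
        L-below zero    u∈L = u∈L
        L-below (suc n) = below n

        L-prefixpoint : (u : Term S X) → ⟦ b ⟧ E (L ∷ₑ β) u → L u
        L-prefixpoint u u∈b (c , refl , q) Fμc =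
          ≤-trans (⟦⟧⇒≲-instance FixInstance-stable L-below
                     (Instance-openAt st (μ c) (c , refl , q) q) u∈b
                     (unfold-closed Fμc Fμc))
                  (μ-unfold Fμc)

proposition5p8 : (S : Signature) (X : Set) (E : Term S X → Term S X → Set) →
    ((s t : Term S X) → E s t → Linear s × Linear t × Regular s t) →
    (F : Expr S X → Set) → IsFragment F →
    (e : Expr S X) → F e →
    (a : Term S X) → ⟦ e ⟧[ E ] a →
    N[ E , F ]⊢ ⌜ a ⌝ ≤ e
proposition5p8 S X E _ F FF e Fe a a∈e =
  ⟦⟧⇒≲-instance E F FF {Q = λ _ _ → ⊥} (λ _ _ _ ()) (λ _ ())
                (Instance-refl e (IsFragment.closed FF Fe)) a∈e Fe
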